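{- For every positive integer $n$, during a complete run of $\mathrm{RuleAsc}(n)$, the write statements executed after initialisation are "$a_k\leftarrow x$" (inside the inner loop) and "$a_k\leftarrow x+y$". Together they are executed a total of exactly $2p(n)-1$ times.
   Context: $p(n)$ denotes the number of partitions of $n$. The procedure $\mathrm{RuleAsc}(n)$, for $n>0$, operates on an array $a$ as follows and visits every ascending composition of $n$ (a sequence of positive integers in nondecreasing order summing to $n$) exactly once, in lexicographic order: 1. Initialisation: $k\leftarrow 2$; $a_1\leftarrow 0$; $a_2\leftarrow n$. 2. While $k\ne 1$: - $y\leftarrow a_k-1$; $k\leftarrow k-1$; $x\leftarrow a_k+1$. - While $x\le y$: $a_k\leftarrow x$; $y\leftarrow y-x$; $k\leftarrow k+1$. - $a_k\leftarrow x+y$; visit $\langle a_1,\dots,a_k\rangle$. -}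

module Defs where

open import Data.Nat using (ℕ; zero; suc; _+_; _∸_; _≤_; _≥_; _≤ᵇ_; _≡ᵇ_)
open import Data.Bool using (Bool; true; false; if_then_else_)
open import Data.List using (List; []; _∷_)
open import Data.Nat.ListAction using (sum)
open import Data.List.Relation.Unary.All using (All)
open import Data.List.Relation.Unary.Linked using (Linked)
open import Data.Product using (_×_)
open import Relation.Binary.PropositionalEquality using (_≡_)

IsPartition : ℕ → List ℕ → Set
IsPartition n xs = All (λ x → 1 ≤ x) xs × Linked _≥_ xs × sum xs ≡ n

-- Program points:
--   outer : test of the outer loop "while k ≠ 1"
--   inner : test of the inner loop "while x ≤ y"
--   halt  : the procedure has finished
data PC : Set where
  outer inner halt : PC

record State : Set where
  constructor st
  field
    pc     : PC
    k      : ℕ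
    x      : ℕ
    y      : ℕ
    a      : ℕ → ℕ
    writes : ℕ          -- number of executions of "a_k ← x" and "a_k ← x+y"
open State public

upd : (ℕ → ℕ) → ℕ → ℕ → (ℕ → ℕ)
upd f i v j = if j ≡ᵇ i then v else f j

-- State right after initialisation: k ← 2; a_1 ← 0; a_2 ← n.
-- (Initialisation writes are not counted.)
start : ℕ → State
start n = st outer 2 0 0 (upd (upd (λ _ → 0) 1 0) 2 n) 0

step : State → State
-- outer loop test; if k ≠ 1 execute the three assignments
-- y ← a_k − 1; k ← k − 1; x ← a_k + 1, then go to the inner loop test
step (st outer k x y a w) =
  if k ≡ᵇ 1
  then st halt k x y a w
  else st inner (k ∸ 1) (a (k ∸ 1) + 1) (a k ∸ 1) a w
-- inner loop: if x ≤ y then a_k ← x; y ← y − x; k ← k + 1 (one counted write)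
--             else a_k ← x + y; visit (one counted write), back to outer test
step (st inner k x y a w) =
  if x ≤ᵇ y
  then st inner (suc k) x (y ∸ x) (upd a k x) (suc w)
  else st outer k x y (upd a k (x + y)) (suc w)
step (st halt k x y a w) = st halt k x y a w

run : ℕ → State → State
run zero    s = s
run (suc t) s = run t (step s)

module Submission where

-- Write nAsc s m for the number of ascending compositions of
-- s with all parts ≥ m; it satisfies nAsc s m = nAsc (s - m) m + nAsc s (m + 1)
-- and p(n) = nAsc n 1 (reverse a partition).  For the current composition
-- a_1 … a_k at the outer-loop test, the potential toGo counts the ascending
-- compositions of n that are lexicographically later: for each position i,
-- those agreeing before i with a larger i-th part, nAsc (a_i + … + a_k) (a_i + 1).
-- One pass of the outer loop from k ≥ 2 replaces the last two parts A, b by the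
-- lexicographically first composition of A + b into parts ≥ A + 1, namely c
-- copies of A + 1 and a final part; it performs c + 1 writes, moves k to k + c - 1
-- and lowers toGo by exactly one.  Hence writes + 2·toGo - k is invariant; it is
-- 2p(n) - 2 initially (k = 2, toGo = p(n)) and the loop halts at k = 1 with
-- toGo = 0, giving 2p(n) - 1 writes.

open import Defs
open import Data.Nat using (ℕ; zero; suc; _+_; _*_; _∸_; _≤_; _<_; z≤n; s≤s; _≤ᵇ_; _≡ᵇ_)
open import Data.Nat.Properties
open import Data.Nat.Induction using (<-wellFounded)
open import Data.Nat.Tactic.RingSolver using (solve-∀)
open import Data.Nat.ListAction using (sum)
open import Data.Nat.ListAction.Properties using (sum-++; sum-↭)
open import Data.Bool using (true; false)
open import Data.List using (List; []; _∷_; length; map; _++_; reverse; _ʳ++_)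
open import Data.List.Properties using (length-++; length-map; reverse-involutive; reverse-injective)
open import Data.List.Relation.Unary.All using (All; []; _∷_)
open import Data.List.Relation.Unary.AllPairs using ([]; _∷_)
open import Data.List.Relation.Unary.Any using (here)
open import Data.List.Relation.Unary.Linked using (Linked; []; [-]; _∷_)
open import Data.List.Relation.Unary.Linked.Properties using (Linked⇒All)
open import Data.List.Relation.Unary.Unique.Propositional using (Unique)
import Data.List.Relation.Unary.Unique.Propositional.Properties as Unique
open import Data.List.Membership.Propositional using (_∈_)
open import Data.List.Membership.Propositional.Properties using (∈-map⁺; ∈-map⁻; ∈-++⁺ˡ; ∈-++⁺ʳ; ∈-++⁻)
open import Data.List.Membership.Propositional.Properties.WithK using (unique∧set⇒bag)
open import Data.List.Relation.Binary.BagAndSetEquality using (∼bag⇒↭)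
open import Data.List.Relation.Binary.Permutation.Propositional using (↭-sym)
open import Data.List.Relation.Binary.Permutation.Propositional.Properties using (↭-length; ↭-reverse; All-resp-↭)
open import Data.Product using (_×_; _,_; ∃-syntax; map₂)
open import Data.Sum using (inj₁; inj₂)
open import Data.Empty using (⊥-elim)
open import Function using (flip)
open import Function.Bundles using (_⇔_; mk⇔; Equivalence)
open import Induction.WellFounded using (Acc; acc)
open import Relation.Nullary using (yes; no; ¬_)
open import Relation.Binary.PropositionalEquality

Asc : ℕ → List ℕ → Set
Asc m xs = Linked _≤_ (m ∷ xs)

ascs : (f s m : ℕ) → List (List ℕ)
ascs zero    s       m = []
ascs (suc f) zero    m = [] ∷ []
ascs (suc f) (suc s) m with m ≤? suc s
... | yes _ = map (m ∷_) (ascs f (suc s ∸ m) m) ++ ascs f (suc s) (suc m)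
... | no  _ = []

-- A bound on the recursion depth of ascs s m (for m ≥ 1): each recursive call
-- either decreases s by m or increases m towards s + 1.
depth : ℕ → ℕ → ℕ
depth s m = s + (suc s ∸ m)

depth-first : ∀ s m → 1 ≤ m → m ≤ s → depth (s ∸ m) m < depth s m
depth-first (suc s) (suc m) _ (s≤s _) =
  +-mono-<-≤ (s≤s (m∸n≤m s m)) (∸-monoˡ-≤ m (≤-trans (m∸n≤m s m) (n≤1+n s)))

depth-second : ∀ s m → m ≤ s → suc (depth s (suc m)) ≡ depth s m
depth-second s m m≤s = trans (sym (+-suc s (s ∸ m))) (cong (s +_) (sym (+-∸-assoc 1 m≤s)))

ascs-fuel : ∀ f g s m → 1 ≤ m → depth s m < f → depth s m < g → ascs f s m ≡ ascs g s m
ascs-fuel (suc f) (suc g) zero    m 1≤m _ _ = refl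
ascs-fuel (suc f) (suc g) (suc s) m 1≤m (s≤s d≤f) (s≤s d≤g) with m ≤? suc s
... | no  _   = refl
... | yes m≤s = cong₂ _++_
  (cong (map (m ∷_)) (ascs-fuel f g (suc s ∸ m) m 1≤m (<-≤-trans first d≤f) (<-≤-trans first d≤g)))
  (ascs-fuel f g (suc s) (suc m) (s≤s z≤n) (second d≤f) (second d≤g))
  where
  first : depth (suc s ∸ m) m < depth (suc s) m
  first = depth-first (suc s) m 1≤m m≤s
  second : ∀ {h} → depth (suc s) m ≤ h → depth (suc s) (suc m) < h
  second = ≤-trans (≤-reflexive (depth-second (suc s) m m≤s))

nAsc : ℕ → ℕ → ℕ
nAsc s m = length (ascs (suc (depth s m)) s m)

nAsc-split : ∀ s m → 1 ≤ m → m ≤ s → nAsc s m ≡ nAsc (s ∸ m) m + nAsc s (suc m)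
nAsc-split zero    (suc m) _ ()
nAsc-split (suc s) m 1≤m m≤s with m ≤? suc s
... | no m≰s = ⊥-elim (m≰s m≤s)
... | yes _  = begin
  length (map (m ∷_) (ascs D (suc s ∸ m) m) ++ ascs D (suc s) (suc m))
    ≡⟨ length-++ (map (m ∷_) (ascs D (suc s ∸ m) m)) ⟩
  length (map (m ∷_) (ascs D (suc s ∸ m) m)) + length (ascs D (suc s) (suc m))
    ≡⟨ cong₂ _+_ (length-map (m ∷_) (ascs D (suc s ∸ m) m)) refl ⟩
  length (ascs D (suc s ∸ m) m) + length (ascs D (suc s) (suc m))
    ≡⟨ cong₂ (λ u v → length u + length v)
         (ascs-fuel D _ (suc s ∸ m) m 1≤m (depth-first (suc s) m 1≤m m≤s) ≤-refl)
         (ascs-fuel D _ (suc s) (suc m) (s≤s z≤n) (≤-reflexive (depth-second (suc s) m m≤s)) ≤-refl) ⟩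
  nAsc (suc s ∸ m) m + nAsc (suc s) (suc m) ∎
  where
  open ≡-Reasoning
  D : ℕ
  D = depth (suc s) m

nAsc-none : ∀ s m → 1 ≤ s → s < m → nAsc s m ≡ 0
nAsc-none (suc s) m _ s<m with m ≤? suc s
... | no  _   = refl
... | yes m≤s = ⊥-elim (<-irrefl refl (<-≤-trans s<m m≤s))

nAsc-one : ∀ d m → 1 ≤ m → d < m → nAsc (m + d) m ≡ 1
nAsc-one zero m 1≤m _ = begin
  nAsc (m + 0) m                  ≡⟨ cong (λ s → nAsc s m) (+-identityʳ m) ⟩
  nAsc m m                        ≡⟨ nAsc-split m m 1≤m ≤-refl ⟩
  nAsc (m ∸ m) m + nAsc m (suc m) ≡⟨ cong₂ (λ s r → nAsc s m + r) (n∸n≡0 m) (nAsc-none m (suc m) 1≤m ≤-refl) ⟩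
  1                               ∎
  where open ≡-Reasoning
nAsc-one (suc d) m 1≤m d<m = begin
  nAsc (m + suc d) m                                ≡⟨ nAsc-split (m + suc d) m 1≤m (m≤m+n m (suc d)) ⟩
  nAsc (m + suc d ∸ m) m + nAsc (m + suc d) (suc m) ≡⟨ cong₂ (λ s r → nAsc s m + nAsc r (suc m)) (m+n∸m≡n m (suc d)) (+-suc m d) ⟩
  nAsc (suc d) m + nAsc (suc m + d) (suc m)         ≡⟨ cong₂ _+_ (nAsc-none (suc d) m (s≤s z≤n) d<m)
                                                         (nAsc-one d (suc m) (s≤s z≤n) (m<n⇒m<1+n (<-trans (n<1+n d) d<m))) ⟩
  1                                                 ∎
  where open ≡-Reasoning

ascs-sound : ∀ f s m {xs} → xs ∈ ascs f s m → Asc m xs × sum xs ≡ s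
ascs-sound (suc f) zero    m (here refl) = [-] , refl
ascs-sound (suc f) (suc s) m {xs} xs∈ with m ≤? suc s
ascs-sound (suc f) (suc s) m () | no _
... | yes m≤s with ∈-++⁻ (map (m ∷_) (ascs f (suc s ∸ m) m)) xs∈
... | inj₂ xs∈' with ascs-sound f (suc s) (suc m) xs∈'
...   | m<x ∷ asc , Σxs = (≤-trans (n≤1+n m) m<x ∷ asc) , Σxs
ascs-sound (suc f) (suc s) m xs∈ | yes m≤s | inj₁ xs∈' with ∈-map⁻ (m ∷_) xs∈'
... | ys , ys∈ , refl = let (asc , Σys) = ascs-sound f (suc s ∸ m) m ys∈ in
  (≤-refl ∷ asc) , trans (cong (m +_) Σys) (m+[n∸m]≡n m≤s)

ascs-complete : ∀ f s m {xs} → 1 ≤ m → depth s m < f → Asc m xs → sum xs ≡ s → xs ∈ ascs f s m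
ascs-complete (suc f) zero    m {[]}     _ _ _ _ = here refl
ascs-complete (suc f) zero    (suc m) {suc x ∷ xs} _ _ (s≤s _ ∷ _) ()
ascs-complete (suc f) (suc s) m {x ∷ xs} 1≤m (s≤s d≤f) (m≤x ∷ asc) Σ≡ with m ≤? suc s
... | no m≰s = ⊥-elim (m≰s (≤-trans m≤x (subst (x ≤_) Σ≡ (m≤m+n x (sum xs)))))
... | yes m≤s with m ≟ x
... | yes refl = ∈-++⁺ˡ (∈-map⁺ (m ∷_)
      (ascs-complete f (suc s ∸ m) m 1≤m (<-≤-trans (depth-first (suc s) m 1≤m m≤s) d≤f) asc
        (trans (sym (m+n∸m≡n m (sum xs))) (cong (_∸ m) Σ≡))))
... | no m≢x = ∈-++⁺ʳ (map (m ∷_) (ascs f (suc s ∸ m) m))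
      (ascs-complete f (suc s) (suc m) (s≤s z≤n)
        (≤-trans (≤-reflexive (depth-second (suc s) m m≤s)) d≤f) (≤∧≢⇒< m≤x m≢x ∷ asc) Σ≡)

ascs-unique : ∀ f s m → Unique (ascs f s m)
ascs-unique zero    s       m = []
ascs-unique (suc f) zero    m = [] ∷ []
ascs-unique (suc f) (suc s) m with m ≤? suc s
... | no  _ = []
... | yes _ = Unique.++⁺ (Unique.map⁺ ∷-injectiveʳ (ascs-unique f (suc s ∸ m) m))
                         (ascs-unique f (suc s) (suc m)) disjoint
  where
  ∷-injectiveʳ : ∀ {xs ys : List ℕ} → m ∷ xs ≡ m ∷ ys → xs ≡ ys
  ∷-injectiveʳ refl = refl
  -- compositions of the first block start with m, those of the second with a part > m
  disjoint : ∀ {zs} → ¬ (zs ∈ map (m ∷_) (ascs f (suc s ∸ m) m) × zs ∈ ascs f (suc s) (suc m))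
  disjoint (zs∈₁ , zs∈₂) with ∈-map⁻ (m ∷_) zs∈₁
  ... | _ , _ , refl with ascs-sound f (suc s) (suc m) zs∈₂
  ... | m<m ∷ _ , _ = <-irrefl refl m<m

linked-reverse : ∀ {R : ℕ → ℕ → Set} {xs} → Linked R xs → Linked (flip R) (reverse xs)
linked-reverse []      = []
linked-reverse {xs = x ∷ xs} l = go l [-]
  where
  go : ∀ {R : ℕ → ℕ → Set} {x xs acc} → Linked R (x ∷ xs) → Linked (flip R) (x ∷ acc) →
       Linked (flip R) (xs ʳ++ (x ∷ acc))
  go [-]          racc = racc
  go (Rxy ∷ rest) racc = go rest (Rxy ∷ racc)

partition⇒asc : ∀ {n xs} → IsPartition n xs → Asc 1 (reverse xs) × sum (reverse xs) ≡ n
partition⇒asc {n} {xs} (positive , descending , Σxs) =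
  prepend (All-resp-↭ (↭-sym (↭-reverse xs)) positive) (linked-reverse descending) ,
  trans (sum-↭ (↭-reverse xs)) Σxs
  where
  prepend : ∀ {ys} → All (1 ≤_) ys → Linked _≤_ ys → Asc 1 ys
  prepend []      []  = [-]
  prepend (p ∷ _) asc = p ∷ asc

asc⇒partition : ∀ {n ys} → Asc 1 ys → sum ys ≡ n → IsPartition n (reverse ys)
asc⇒partition {n} {ys} asc Σys =
  All-resp-↭ (↭-sym (↭-reverse ys)) (positive asc) ,
  linked-reverse (tail asc) ,
  trans (sum-↭ (↭-reverse ys)) Σys
  where
  positive : ∀ {zs} → Asc 1 zs → All (1 ≤_) zs
  positive [-]         = []
  positive (1≤z ∷ asc) = Linked⇒All ≤-trans 1≤z asc
  tail : ∀ {zs} → Asc 1 zs → Linked _≤_ zs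
  tail [-]       = []
  tail (_ ∷ asc) = asc

unique-length : ∀ {xs ys : List (List ℕ)} → Unique xs → Unique ys →
                (∀ {v} → v ∈ xs ⇔ v ∈ ys) → length xs ≡ length ys
unique-length uxs uys same = ↭-length (∼bag⇒↭ (unique∧set⇒bag uxs uys same))

-- Hence p(n) = nAsc n 1: any duplicate-free enumeration of the partitions of n
-- has nAsc n 1 elements, being in bijection (via reverse) with ascs.
partitions-count : ∀ n (L : List (List ℕ)) → Unique L →
                   ((xs : List ℕ) → (xs ∈ L) ⇔ IsPartition n xs) → length L ≡ nAsc n 1
partitions-count n L uL L⇔ =
  trans (unique-length uL (Unique.map⁺ reverse-injective (ascs-unique F n 1)) (mk⇔ to from))
        (length-map reverse (ascs F n 1))
  where
  F : ℕ
  F = suc (depth n 1)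
  to : ∀ {xs} → xs ∈ L → xs ∈ map reverse (ascs F n 1)
  to {xs} xs∈ with partition⇒asc (Equivalence.to (L⇔ xs) xs∈)
  ... | asc , Σ≡ = subst (_∈ map reverse (ascs F n 1)) (reverse-involutive xs)
                     (∈-map⁺ reverse (ascs-complete F n 1 (s≤s z≤n) ≤-refl asc Σ≡))
  from : ∀ {xs} → xs ∈ map reverse (ascs F n 1) → xs ∈ L
  from xs∈ with ∈-map⁻ reverse xs∈
  ... | ys , ys∈ , refl with ascs-sound F n 1 ys∈
  ... | asc , Σys = Equivalence.from (L⇔ (reverse ys)) (asc⇒partition asc Σys)

_↝_ : State → State → Set
s ↝ s' = ∃[ t ] run t s ≡ s'

run-+ : ∀ t₁ t₂ s → run (t₁ + t₂) s ≡ run t₂ (run t₁ s)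
run-+ zero     t₂ s = refl
run-+ (suc t₁) t₂ s = run-+ t₁ t₂ (step s)

↝-eventually : ∀ {P : State → Set} {s s'} → s ↝ s' → ∃[ t ] P (run t s') → ∃[ t ] P (run t s)
↝-eventually {P} (t₁ , refl) (t₂ , p) = t₁ + t₂ , subst P (sym (run-+ t₁ t₂ _)) p

↝-step : ∀ {s s₁ s'} → step s ≡ s₁ → s₁ ↝ s' → s ↝ s'
↝-step refl (t , reach) = suc t , reach

upd-same : ∀ a j v → upd a j v j ≡ v
upd-same a j v with j ≡ᵇ j | ≡⇒≡ᵇ j j refl
... | true | _ = refl

upd-other : ∀ a j v l → l ≢ j → upd a j v l ≡ a l
upd-other a j v l l≢j with l ≡ᵇ j | ≡ᵇ⇒≡ l j
... | false | _    = refl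
... | true  | l≡j = ⊥-elim (l≢j (l≡j _))

step-write : ∀ {k x y a w} → x ≤ y →
             step (st inner k x y a w) ≡ st inner (suc k) x (y ∸ x) (upd a k x) (suc w)
step-write {x = x} {y} x≤y with x ≤ᵇ y | ≤⇒≤ᵇ x≤y
... | true | _ = refl

step-visit : ∀ {k x y a w} → y < x →
             step (st inner k x y a w) ≡ st outer k x y (upd a k (x + y)) (suc w)
step-visit {x = x} {y} y<x with x ≤ᵇ y | ≤ᵇ⇒≤ x y
... | false | _   = refl
... | true  | x≤y = ⊥-elim (<⇒≱ y<x (x≤y _))

window : (ℕ → ℕ) → ℕ → ℕ → List ℕ
window a i zero    = []
window a i (suc f) = a i ∷ window a (suc i) f

window-++ : ∀ a i f g → window a i (f + g) ≡ window a i f ++ window a (i + f) g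
window-++ a i zero    g = cong (λ i' → window a i' g) (sym (+-identityʳ i))
window-++ a i (suc f) g = cong (a i ∷_)
  (trans (window-++ a (suc i) f g) (cong (λ i' → window a (suc i) f ++ window a i' g) (sym (+-suc i f))))

window-agree : ∀ a b i f → (∀ l → l < i + f → a l ≡ b l) → window a i f ≡ window b i f
window-agree a b i zero    _     = refl
window-agree a b i (suc f) a≗b = cong₂ _∷_
  (a≗b i (subst (i <_) (sym (+-suc i f)) (s≤s (m≤m+n i f))))
  (window-agree a b (suc i) f (λ l l< → a≗b l (subst (l <_) (sym (+-suc i f)) l<)))

-- later r cs: for an ascending composition cs of r, the number of ascending compositions
-- of r that come after cs in lexicographic order (for each position, those
-- agreeing with cs before it and having a larger part there).
later : ℕ → List ℕ → ℕ
later r []       = 0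
later r (x ∷ xs) = nAsc r (suc x) + later (r ∸ x) xs

later-++ : ∀ r xs ys → later r (xs ++ ys) ≡ later r xs + later (r ∸ sum xs) ys
later-++ r []       ys = refl
later-++ r (x ∷ xs) ys = trans
  (cong (nAsc r (suc x) +_) (trans (later-++ (r ∸ x) xs ys)
    (cong (λ r' → later (r ∸ x) xs + later r' ys) (∸-+-assoc r x (sum xs)))))
  (sym (+-assoc (nAsc r (suc x)) _ _))

-- The effect of the inner loop entered at position j with x ≥ 1: it writes c
-- copies of x and then a final part, i.e. the lexicographically first ascending
-- composition of x + y into parts ≥ x, using c + 1 writes and leaving the
-- entries below j untouched; every other such composition comes later.
record InnerRun (j x y : ℕ) (a : ℕ → ℕ) (w : ℕ) : Set where
  field
    c           : ℕ
    x' y'       : ℕ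
    a'          : ℕ → ℕ
    reaches     : st inner j x y a w ↝ st outer (j + c) x' y' a' (w + suc c)
    keeps       : ∀ l → l < j → a' l ≡ a l
    block-sum   : sum (window a' j (suc c)) ≡ x + y
    block-last  : 1 ≤ a' (j + c)
    block-later : suc (later (x + y) (window a' j (suc c))) ≡ nAsc (x + y) x

inner-loop : ∀ j x y a w → 1 ≤ x → Acc _<_ y → InnerRun j x y a w
inner-loop j x y a w 1≤x (acc smaller) with x ≤? y
... | no x≰y = record
  { c = 0 ; x' = x ; y' = y ; a' = upd a j (x + y)
  ; reaches = ↝-step (step-visit y<x)
      (0 , cong₂ (λ k w' → st outer k x y (upd a j (x + y)) w') (sym (+-identityʳ j)) (+-comm 1 w))
  ; keeps = λ l l<j → upd-other a j (x + y) l (<⇒≢ l<j)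
  ; block-sum = trans (+-identityʳ _) (upd-same a j (x + y))
  ; block-last = subst (λ k → 1 ≤ upd a j (x + y) k) (sym (+-identityʳ j))
      (subst (1 ≤_) (sym (upd-same a j (x + y))) (≤-trans 1≤x (m≤m+n x y)))
  ; block-later = begin
      suc (nAsc (x + y) (suc (upd a j (x + y) j)) + 0)
        ≡⟨ cong (λ v → suc (nAsc (x + y) (suc v) + 0)) (upd-same a j (x + y)) ⟩
      suc (nAsc (x + y) (suc (x + y)) + 0)
        ≡⟨ cong (λ v → suc (v + 0)) (nAsc-none (x + y) (suc (x + y)) (≤-trans 1≤x (m≤m+n x y)) ≤-refl) ⟩
      1
        ≡⟨ sym (nAsc-one y x 1≤x y<x) ⟩
      nAsc (x + y) x ∎
  }
  where
  open ≡-Reasoning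
  y<x : y < x
  y<x = ≰⇒> x≰y
... | yes x≤y = record
  { c = suc c ; x' = x' ; y' = y' ; a' = a'
  ; reaches = ↝-step (step-write x≤y) (subst (st inner (suc j) x (y ∸ x) (upd a j x) (suc w) ↝_)
      (cong₂ (λ k w' → st outer k x' y' a' w') (sym (+-suc j c)) (sym (+-suc w (suc c)))) reaches)
  ; keeps = λ l l<j → trans (keeps l (m<n⇒m<1+n l<j)) (upd-other a j x l (<⇒≢ l<j))
  ; block-sum = cong₂ _+_ a'j≡x (trans block-sum (m+[n∸m]≡n x≤y))
  ; block-last = subst (λ k → 1 ≤ a' k) (sym (+-suc j c)) block-last
  ; block-later = begin
      suc (nAsc (x + y) (suc (a' j)) + later (x + y ∸ a' j) rest)
        ≡⟨ cong (λ v → suc (nAsc (x + y) (suc v) + later (x + y ∸ v) rest)) a'j≡x ⟩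
      suc (nAsc (x + y) (suc x) + later (x + y ∸ x) rest)
        ≡⟨ sym (+-suc _ _) ⟩
      nAsc (x + y) (suc x) + suc (later (x + y ∸ x) rest)
        ≡⟨ cong (λ r → nAsc (x + y) (suc x) + suc (later r rest)) (m+n∸m≡n x y) ⟩
      nAsc (x + y) (suc x) + suc (later y rest)
        ≡⟨ cong (nAsc (x + y) (suc x) +_) rest-later ⟩
      nAsc (x + y) (suc x) + nAsc y x
        ≡⟨ +-comm (nAsc (x + y) (suc x)) (nAsc y x) ⟩
      nAsc y x + nAsc (x + y) (suc x)
        ≡⟨ cong (λ r → nAsc r x + nAsc (x + y) (suc x)) (sym (m+n∸m≡n x y)) ⟩
      nAsc (x + y ∸ x) x + nAsc (x + y) (suc x)
        ≡⟨ sym (nAsc-split (x + y) x 1≤x (m≤m+n x y)) ⟩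
      nAsc (x + y) x ∎
  }
  where
  open ≡-Reasoning
  -- after writing a_j ← x, the loop continues with y - x < y
  open InnerRun (inner-loop (suc j) x (y ∸ x) (upd a j x) (suc w) 1≤x (smaller (∸-monoʳ-< 1≤x x≤y)))
  rest : List ℕ
  rest = window a' (suc j) (suc c)
  a'j≡x : a' j ≡ x
  a'j≡x = trans (keeps j ≤-refl) (upd-same a j x)
  rest-later : suc (later y rest) ≡ nAsc y x
  rest-later = subst (λ r → suc (later r rest) ≡ nAsc r x) (m+[n∸m]≡n x≤y) block-later

-- Invariant at the outer-loop test with k = m + 1: the current composition
-- a_1 … a_k sums to n and its last part is positive.
record Visiting (n m : ℕ) (a : ℕ → ℕ) : Set where
  field
    total    : sum (window a 1 (suc m)) ≡ n
    positive : 1 ≤ a (suc m)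

toGo : ℕ → ℕ → (ℕ → ℕ) → ℕ
toGo n m a = later n (window a 1 (suc m))

-- A positive last part b has no larger successor, so only the part before it counts.
later-pair : ∀ A b → 1 ≤ b → later (A + b) (A ∷ b ∷ []) ≡ nAsc (A + b) (suc A)
later-pair A b 1≤b = begin
  nAsc (A + b) (suc A) + (nAsc (A + b ∸ A) (suc b) + 0) ≡⟨ cong (λ r → nAsc (A + b) (suc A) + (nAsc r (suc b) + 0)) (m+n∸m≡n A b) ⟩
  nAsc (A + b) (suc A) + (nAsc b (suc b) + 0)         ≡⟨ cong (λ v → nAsc (A + b) (suc A) + (v + 0)) (nAsc-none b (suc b) 1≤b ≤-refl) ⟩
  nAsc (A + b) (suc A) + 0                            ≡⟨ +-identityʳ _ ⟩
  nAsc (A + b) (suc A)                                ∎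
  where open ≡-Reasoning

-- One pass of the outer loop from k = m + 2: it replaces the last two parts
-- A, b by the first ascending composition of A + b into parts ≥ A + 1,
-- visiting the next composition; the potential drops by exactly one.
record OuterPass (n m x y : ℕ) (a : ℕ → ℕ) (w : ℕ) : Set where
  field
    c        : ℕ
    x' y'    : ℕ
    a'       : ℕ → ℕ
    reaches  : st outer (suc (suc m)) x y a w ↝ st outer (suc (m + c)) x' y' a' (w + suc c)
    visiting : Visiting n (m + c) a'
    progress : suc (toGo n (m + c) a') ≡ toGo n (suc m) a

outer-pass : ∀ n m x y a w → Visiting n (suc m) a → OuterPass n m x y a w
outer-pass n m x y a w vis = record
  { c = c ; x' = x' ; y' = y' ; a' = a'
  ; reaches = ↝-step refl reaches
  ; visiting = record { total = total' ; positive = block-last }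
  ; progress = begin
      suc (later n (window a' 1 (suc (m + c))))         ≡⟨ cong (λ cs → suc (later n cs)) new-split ⟩
      suc (later n (prefix ++ block))                    ≡⟨ cong suc (later-++ n prefix block) ⟩
      suc (later n prefix + later (n ∸ sum prefix) block) ≡⟨ sym (+-suc _ _) ⟩
      later n prefix + suc (later (n ∸ sum prefix) block) ≡⟨ cong (λ r → later n prefix + suc (later r block)) rest ⟩
      later n prefix + suc (later (A + b) block)         ≡⟨ cong (later n prefix +_) block-later' ⟩
      later n prefix + nAsc (A + b) (suc A)              ≡⟨ cong (later n prefix +_) (sym (later-pair A b 1≤b)) ⟩
      later n prefix + later (A + b) (A ∷ b ∷ [])        ≡⟨ cong (λ r → later n prefix + later r (A ∷ b ∷ [])) (sym rest) ⟩
      later n prefix + later (n ∸ sum prefix) (A ∷ b ∷ []) ≡⟨ sym (later-++ n prefix (A ∷ b ∷ [])) ⟩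
      later n (prefix ++ A ∷ b ∷ [])                     ≡⟨ cong (later n) (sym old-split) ⟩
      later n (window a 1 (suc (suc m)))                 ∎
  }
  where
  open ≡-Reasoning
  open Visiting vis renaming (positive to 1≤b)
  A b : ℕ
  A = a (suc m)
  b = a (suc (suc m))
  -- the step "y ← a_k - 1; k ← k - 1; x ← a_k + 1" enters the inner loop
  open InnerRun (inner-loop (suc m) (A + 1) (b ∸ 1) a w (m≤n+m 1 A) (<-wellFounded (b ∸ 1)))
  prefix block : List ℕ
  prefix = window a 1 m
  block  = window a' (suc m) (suc c)
  x+y≡A+b : A + 1 + (b ∸ 1) ≡ A + b
  x+y≡A+b = trans (+-assoc A 1 (b ∸ 1)) (cong (A +_) (m+[n∸m]≡n 1≤b))
  block-later' : suc (later (A + b) block) ≡ nAsc (A + b) (suc A)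
  block-later' = subst (λ r → suc (later r block) ≡ nAsc r (suc A)) x+y≡A+b
    (subst (λ z → suc (later (A + 1 + (b ∸ 1)) block) ≡ nAsc (A + 1 + (b ∸ 1)) z) (+-comm A 1) block-later)
  old-split : window a 1 (suc (suc m)) ≡ prefix ++ A ∷ b ∷ []
  old-split = trans (cong (window a 1) (+-comm 2 m)) (window-++ a 1 m 2)
  new-split : window a' 1 (suc (m + c)) ≡ prefix ++ block
  new-split = trans (cong (window a' 1) (sym (+-suc m c)))
    (trans (window-++ a' 1 m (suc c)) (cong (_++ block) (window-agree a' a 1 m keeps)))
  old-total : sum prefix + (A + b) ≡ n
  old-total = trans (cong (λ v → sum prefix + (A + v)) (sym (+-identityʳ b)))
    (trans (sym (sum-++ prefix (A ∷ b ∷ []))) (trans (cong sum (sym old-split)) total))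
  rest : n ∸ sum prefix ≡ A + b
  rest = trans (cong (_∸ sum prefix) (sym old-total)) (m+n∸m≡n (sum prefix) (A + b))
  total' : sum (window a' 1 (suc (m + c))) ≡ n
  total' = begin
    sum (window a' 1 (suc (m + c))) ≡⟨ cong sum new-split ⟩
    sum (prefix ++ block)           ≡⟨ sum-++ prefix block ⟩
    sum prefix + sum block          ≡⟨ cong (sum prefix +_) (trans block-sum x+y≡A+b) ⟩
    sum prefix + (A + b)            ≡⟨ old-total ⟩
    n                               ∎

-- At k = 1 the composition is ⟨n⟩, the last one: nothing comes after it.
toGo-final : ∀ n a → Visiting n 0 a → toGo n 0 a ≡ 0
toGo-final n a vis = trans (+-identityʳ _) (subst (λ v → nAsc n (suc v) ≡ 0) (sym a₁≡n)
  (nAsc-none n (suc n) (subst (1 ≤_) a₁≡n positive) ≤-refl))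
  where
  open Visiting vis
  a₁≡n : a 1 ≡ n
  a₁≡n = trans (sym (+-identityʳ (a 1))) total

-- Bookkeeping of one pass: c + 1 writes, k grows by c - 1, potential drops by 1.
writes-shift : ∀ z m c w v → z + (m + c) ≡ w + suc c + 2 * v → z + suc m ≡ w + 2 * suc v
writes-shift z m c w v eq = +-cancelʳ-≡ c _ _ (begin
  z + suc m + c         ≡⟨ shuffle₁ z m c ⟩
  suc (z + (m + c))     ≡⟨ cong suc eq ⟩
  suc (w + suc c + 2 * v) ≡⟨ shuffle₂ w c v ⟩
  w + 2 * suc v + c     ∎)
  where
  open ≡-Reasoning
  shuffle₁ : ∀ z m c → z + suc m + c ≡ suc (z + (m + c))
  shuffle₁ = solve-∀
  shuffle₂ : ∀ w c v → suc (w + suc c + 2 * v) ≡ w + 2 * suc v + c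
  shuffle₂ = solve-∀

outer-loop : ∀ n v m x y a w → Visiting n m a → toGo n m a ≡ v →
  ∃[ t ] (pc (run t (st outer (suc m) x y a w)) ≡ halt
          × writes (run t (st outer (suc m) x y a w)) + m ≡ w + 2 * v)
outer-loop n v zero x y a w vis refl =
  1 , refl , cong (λ v → w + 2 * v) (sym (toGo-final n a vis))
outer-loop n zero (suc m) x y a w vis toGo≡0 =
  ⊥-elim (1+n≢0 (trans (OuterPass.progress (outer-pass n m x y a w vis)) toGo≡0))
outer-loop n (suc v) (suc m) x y a w vis toGo≡v =
  ↝-eventually {P = λ s → pc s ≡ halt × writes s + suc m ≡ w + 2 * suc v} reaches
    (map₂ (map₂ (writes-shift _ m c w v))
      (outer-loop n v (m + c) x' y' a' (w + suc c) visiting (suc-injective (trans progress toGo≡v))))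
  where open OuterPass (outer-pass n m x y a w vis)

initially : ∀ n → 1 ≤ n → Visiting n 1 (a (start n))
initially n 1≤n = record { total = cong (0 +_) (+-identityʳ n) ; positive = 1≤n }

-- Initially a₁ = 0 contributes p(n) = nAsc n 1 and a₂ = n contributes nothing.
toGo-initially : ∀ n → 1 ≤ n → toGo n 1 (a (start n)) ≡ nAsc n 1
toGo-initially n 1≤n = trans (cong (nAsc n 1 +_) (trans (+-identityʳ _) (nAsc-none n (suc n) 1≤n ≤-refl)))
                             (+-identityʳ (nAsc n 1))

theorem3p8 : (n : ℕ) → 1 ≤ n → (L : List (List ℕ)) → Unique L →
    ((xs : List ℕ) → (xs ∈ L) ⇔ IsPartition n xs) →
    ∃[ t ] (pc (run t (start n)) ≡ halt × writes (run t (start n)) ≡ 2 * length L ∸ 1)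
theorem3p8 n 1≤n L uL L⇔ = map₂ (map₂ count) (outer-loop n p 1 0 0 (a (start n)) 0 (initially n 1≤n) toGo≡p)
  where
  p : ℕ
  p = length L
  toGo≡p : toGo n 1 (a (start n)) ≡ p
  toGo≡p = trans (toGo-initially n 1≤n) (sym (partitions-count n L uL L⇔))
  count : ∀ {z} → z + 1 ≡ 0 + 2 * p → z ≡ 2 * p ∸ 1
  count {z} eq = trans (sym (m+n∸n≡m z 1)) (cong (_∸ 1) eq)
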